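{- For all natural numbers $p$ and $q$, $\mathcal{R}_1(p,q,1)>p+q-2$.
   Context: $T_n=n(n+1)/2$, $T_0=0$. A finite set $X\subseteq\mathbb{N}$ with $|X|=T_n$, enumerated $x_1<\dots<x_{T_n}$, has $i$-th level $\{x_{T_{i-1}+1},\dots,x_{T_i}\}$ for $1\le i\le n$; $\triangle_n$ is the set of all such sets. For such sets, $X\le Y$ means $X\subseteq Y$ and every level of $X$ is contained in a single level of $Y$, distinct levels of $X$ being contained in distinct levels of $Y$; $\triangle_k(B)=\{Z\in\triangle_k:Z\le B\}$. For natural numbers $k\le p,q$, a completed game of Mines$_m(p,q,k)$ is a partition $\triangle_k(B)=X\sqcup Y$, where $B\in\triangle_m$; it is a win for player one if there is $Z\in\triangle_p(B)$ with $\triangle_k(Z)\subseteq X$, a win for player two if there is $Z\in\triangle_q(B)$ with $\triangle_k(Z)\subseteq Y$, and a draw otherwise. The triangular Ramsey number $\mathcal{R}_1(p,q,k)$ is the least natural number $m\ge\max(p,q)$ such that no completed game of Mines$_m(p,q,k)$ is a draw (such $m$ exists). -}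

module Defs where

open import Data.Nat using (ℕ; zero; suc; _+_; _≤_; _<_; _⊔_)
open import Data.Fin using (Fin; toℕ)
open import Data.Bool using (Bool; true; false)
open import Data.List using (List; length; take; drop)
open import Data.List.Membership.Propositional using (_∈_)
open import Data.List.Relation.Unary.AllPairs using (AllPairs)
open import Data.Product using (Σ; _×_)
open import Relation.Binary.PropositionalEquality using (_≡_)
open import Relation.Nullary using (¬_)
open import Function.Definitions using (Injective)

T : ℕ → ℕ
T zero = 0
T (suc n) = suc n + T n

-- A finite subset of ℕ is represented by its increasing enumeration x₁ < ... < x_N.
-- X ∈ △ₙ
IsTri : ℕ → List ℕ → Set
IsTri n xs = AllPairs _<_ xs × length xs ≡ T n

-- The (j+1)-th level (0-indexed j): {x_{T j + 1}, ..., x_{T (j+1)}}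
level : List ℕ → ℕ → List ℕ
level xs j = take (suc j) (drop (T j) xs)

Emb : ℕ → ℕ → List ℕ → List ℕ → Set
Emb k n X Y =
  (∀ {x} → x ∈ X → x ∈ Y) ×
  Σ (Fin k → Fin n) (λ f → Injective _≡_ _≡_ f ×
     (∀ i {x} → x ∈ level X (toℕ i) → x ∈ level Y (toℕ (f i))))

-- A partition △ₖ(B) = X ⊔ Y is given by a colouring c (true ↦ X, false ↦ Y);
-- only its values on △ₖ(B) matter.
Colouring : Set
Colouring = List ℕ → Bool

Mono : ℕ → ℕ → ℕ → List ℕ → Colouring → Bool → Set
Mono p k m B c b =
  Σ (List ℕ) λ Z → IsTri p Z × Emb p m Z B ×
    (∀ W → IsTri k W → Emb k p W Z → c W ≡ b)

-- completed game of Mines_m(p,q,k) on board B with partition c is a draw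
Draw : ℕ → ℕ → ℕ → ℕ → List ℕ → Colouring → Set
Draw p q k m B c = ¬ Mono p k m B c true × ¬ Mono q k m B c false

NoDraw : ℕ → ℕ → ℕ → ℕ → Set
NoDraw p q k m = ∀ B → IsTri m B → ∀ (c : Colouring) → ¬ Draw p q k m B c

IsR1 : ℕ → ℕ → ℕ → ℕ → Set
IsR1 p q k m =
  (p ⊔ q ≤ m) × NoDraw p q k m ×
  (∀ m' → p ⊔ q ≤ m' → NoDraw p q k m' → m ≤ m')

-- Split the T m points of the board [0, T m) into its first P levels and the
-- remaining m − P ≤ Q levels, and colour a singleton by the part containing it.
-- A triangle Z ∈ △_{P+1}(B) has P + 1 levels, sitting injectively in distinct
-- levels of B, and each point of Z is a singleton of △₁(Z); so a monochromatic
-- Z would inject P + 1 levels into P (colour one) or into at most Q levels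
-- (colour two).  Hence Mines_m(P+1, Q+1, 1) has a draw whenever m ≤ P + Q.
module Submission where

open import Defs
open import Data.Nat using (ℕ; zero; suc; _+_; _∸_; _≤_; _<_; z≤n; s≤s; z<s; _≤?_; _<?_)
open import Data.Nat.Properties
open import Data.Fin using (Fin; toℕ; fromℕ<)
open import Data.Fin.Properties using (injective⇒≤; toℕ-injective; toℕ<n; toℕ-fromℕ<)
open import Data.Bool using (true; false)
open import Data.List using (List; []; _∷_; length; take; drop)
open import Data.List.Membership.Propositional using (_∈_)
open import Data.List.Relation.Unary.Any using (here; there)
open import Data.List.Relation.Unary.All using (All; []; _∷_)
open import Data.List.Relation.Unary.AllPairs using (AllPairs; []; _∷_)
open import Data.List.Relation.Binary.Sublist.Propositional using (_⊆_; ⊆-trans; lookup)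
open import Data.List.Relation.Binary.Sublist.Propositional.Properties using (take-⊆; drop-⊆)
open import Data.Product using (Σ; ∃; _×_; _,_)
open import Data.Empty using (⊥-elim)
open import Relation.Binary.PropositionalEquality
open import Relation.Nullary using (¬_; yes; no)
open import Relation.Nullary.Decidable using (⌊_⌋)
open import Function.Definitions using (Injective)

T-mono-≤ : ∀ {i j} → i ≤ j → T i ≤ T j
T-mono-≤ {zero}  _         = z≤n
T-mono-≤ {suc i} (s≤s i≤j) = +-mono-≤ (s≤s i≤j) (T-mono-≤ i≤j)

T-cancel-< : ∀ {i j} → T i < T j → i < j
T-cancel-< {i} {j} Ti<Tj with j ≤? i
... | yes j≤i = ⊥-elim (<⇒≱ Ti<Tj (T-mono-≤ j≤i))
... | no  j≰i = ≰⇒> j≰i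

T-mono-< : ∀ {i j} → i < j → T i < T j
T-mono-< {i} i<j = ≤-trans (s≤s (m≤n+m (T i) i)) (T-mono-≤ i<j)

interval : ℕ → ℕ → List ℕ
interval a zero    = []
interval a (suc n) = a ∷ interval (suc a) n

length-interval : ∀ a n → length (interval a n) ≡ n
length-interval a zero    = refl
length-interval a (suc n) = cong suc (length-interval (suc a) n)

interval-above : ∀ {a} b n → a < b → All (a <_) (interval b n)
interval-above b zero    _   = []
interval-above b (suc n) a<b = a<b ∷ interval-above (suc b) n (m<n⇒m<1+n a<b)

interval-increasing : ∀ a n → AllPairs _<_ (interval a n)
interval-increasing a zero    = []
interval-increasing a (suc n) = interval-above (suc a) n ≤-refl ∷ interval-increasing (suc a) n

interval-isTri : ∀ m → IsTri m (interval 0 (T m))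
interval-isTri m = interval-increasing 0 (T m) , length-interval 0 (T m)

drop-interval : ∀ d a n → drop d (interval a n) ≡ interval (d + a) (n ∸ d)
drop-interval zero    a n       = refl
drop-interval (suc d) a zero    = refl
drop-interval (suc d) a (suc n) =
  trans (drop-interval d (suc a) n) (cong (λ b → interval b (n ∸ d)) (+-suc d a))

∈-take-interval : ∀ {x} t a n → x ∈ take t (interval a n) → a ≤ x × x < a + t
∈-take-interval (suc t) a (suc n) (here refl) = ≤-refl , m<m+n a z<s
∈-take-interval {x} (suc t) a (suc n) (there x∈) with ∈-take-interval t (suc a) n x∈
... | a<x , x<1+a+t = <⇒≤ a<x , subst (x <_) (sym (+-suc a t)) x<1+a+t

∈-level-interval : ∀ {x} N j → x ∈ level (interval 0 N) j → T j ≤ x × x < T (suc j)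
∈-level-interval {x} N j x∈ rewrite drop-interval (T j) 0 N | +-identityʳ (T j)
  with ∈-take-interval (suc j) (T j) (N ∸ T j) x∈
... | Tj≤x , x<Tj+1+j = Tj≤x , subst (x <_) (+-comm (T j) (suc j)) x<Tj+1+j

level-⊆ : ∀ xs j → level xs j ⊆ xs
level-⊆ xs j = ⊆-trans (take-⊆ (suc j) (drop (T j) xs)) (drop-⊆ (T j) xs)

take-drop-nonempty : ∀ (xs : List ℕ) d t → d < length xs → ∃ λ x → x ∈ take (suc t) (drop d xs)
take-drop-nonempty (x ∷ xs) zero    t _           = x , here refl
take-drop-nonempty (x ∷ xs) (suc d) t (s≤s d<len) = take-drop-nonempty xs d t d<len

point-of-level : ∀ {p} Z → IsTri p Z → (i : Fin p) → ∃ λ x → x ∈ level Z (toℕ i)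
point-of-level Z (_ , len) i =
  take-drop-nonempty Z (T (toℕ i)) (toℕ i) (subst (_ <_) (sym len) (T-mono-< (toℕ<n i)))

singleton-isTri : ∀ x → IsTri 1 (x ∷ [])
singleton-isTri x = [] ∷ [] , refl

singleton-emb : ∀ {p x} Z (i : Fin p) → x ∈ level Z (toℕ i) → Emb 1 p (x ∷ []) Z
singleton-emb Z i x∈ = point⊆Z , (λ _ → i) , const-injective , λ { Fin.zero (here refl) → x∈ }
  where
  point⊆Z : ∀ {y} → y ∈ _ ∷ [] → y ∈ Z
  point⊆Z (here refl) = lookup (level-⊆ Z (toℕ i)) x∈

  const-injective : Injective _≡_ _≡_ (λ (_ : Fin 1) → i)
  const-injective {Fin.zero} {Fin.zero} _ = refl

mono₁⇒coloured-levels : ∀ {p m B c b} → Mono p 1 m B c b →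
  Σ (Fin p → Fin m) λ f → Injective _≡_ _≡_ f ×
    (∀ i → ∃ λ x → x ∈ level B (toℕ (f i)) × c (x ∷ []) ≡ b)
mono₁⇒coloured-levels {B = B} {c} {b} (Z , Z-tri , (_ , f , f-inj , f-levels) , Z-mono) =
  f , f-inj , coloured
  where
  coloured : ∀ i → ∃ λ x → x ∈ level B (toℕ (f i)) × c (x ∷ []) ≡ b
  coloured i with point-of-level Z Z-tri i
  ... | x , x∈ = x , f-levels i x∈ , Z-mono (x ∷ []) (singleton-isTri x) (singleton-emb Z i x∈)

injective-into-interval⇒≤ : ∀ {k n lo hi} (f : Fin k → Fin n) → Injective _≡_ _≡_ f →
  (∀ i → lo ≤ toℕ (f i) × toℕ (f i) < hi) → k ≤ hi ∸ lo
injective-into-interval⇒≤ {k} {lo = lo} {hi} f f-inj bounds = injective⇒≤ shift-injective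
  where
  shifted< : ∀ i → toℕ (f i) ∸ lo < hi ∸ lo
  shifted< i with bounds i
  ... | lo≤fi , fi<hi = ∸-monoˡ-< fi<hi lo≤fi

  shift : Fin k → Fin (hi ∸ lo)
  shift i = fromℕ< (shifted< i)

  toℕ-shift : ∀ i → toℕ (shift i) + lo ≡ toℕ (f i)
  toℕ-shift i with bounds i
  ... | lo≤fi , _ = trans (cong (_+ lo) (toℕ-fromℕ< (shifted< i))) (m∸n+n≡m lo≤fi)

  shift-injective : Injective _≡_ _≡_ shift
  shift-injective {i} {j} eq = f-inj (toℕ-injective (begin
    toℕ (f i)          ≡⟨ toℕ-shift i ⟨
    toℕ (shift i) + lo ≡⟨ cong (λ s → toℕ s + lo) eq ⟩
    toℕ (shift j) + lo ≡⟨ toℕ-shift j ⟩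
    toℕ (f j)          ∎))
    where open ≡-Reasoning

-- △₁(B) consists of singletons; the value on [] is irrelevant.
firstLevels : ℕ → Colouring
firstLevels P []      = true
firstLevels P (x ∷ _) = ⌊ x <? T P ⌋

firstLevels-true : ∀ P x → firstLevels P (x ∷ []) ≡ true → x < T P
firstLevels-true P x eq with x <? T P
... | yes x<TP = x<TP

firstLevels-false : ∀ P x → firstLevels P (x ∷ []) ≡ false → T P ≤ x
firstLevels-false P x eq with x <? T P
... | no x≮TP = ≮⇒≥ x≮TP

module _ (P Q m : ℕ) (m≤P+Q : m ≤ P + Q) where

  board : List ℕ
  board = interval 0 (T m)

  no-first-win : ¬ Mono (suc P) 1 m board (firstLevels P) true
  no-first-win mono with mono₁⇒coloured-levels mono
  ... | f , f-inj , coloured =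
    1+n≰n (injective-into-interval⇒≤ f f-inj bounds)
    where
    bounds : ∀ i → 0 ≤ toℕ (f i) × toℕ (f i) < P
    bounds i with coloured i
    ... | x , x∈ , cx with ∈-level-interval (T m) (toℕ (f i)) x∈
    ...   | Tj≤x , _ = z≤n , T-cancel-< (≤-<-trans Tj≤x (firstLevels-true P x cx))

  no-second-win : ¬ Mono (suc Q) 1 m board (firstLevels P) false
  no-second-win mono with mono₁⇒coloured-levels mono
  ... | f , f-inj , coloured =
    1+n≰n (≤-trans (injective-into-interval⇒≤ f f-inj bounds) m∸P≤Q)
    where
    m∸P≤Q : m ∸ P ≤ Q
    m∸P≤Q = subst (m ∸ P ≤_) (m+n∸m≡n P Q) (∸-monoˡ-≤ P m≤P+Q)

    bounds : ∀ i → P ≤ toℕ (f i) × toℕ (f i) < m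
    bounds i with coloured i
    ... | x , x∈ , cx with ∈-level-interval (T m) (toℕ (f i)) x∈
    ...   | _ , x<T[1+j] = ≤-pred (T-cancel-< (≤-<-trans (firstLevels-false P x cx) x<T[1+j])) , toℕ<n (f i)

  draw : Draw (suc P) (suc Q) 1 m board (firstLevels P)
  draw = no-first-win , no-second-win

lemma2 : (p q : ℕ) → 1 ≤ p → 1 ≤ q →
    (m : ℕ) → IsR1 p q 1 m → p + q ∸ 2 < m
lemma2 (suc P) (suc Q) _ _ m (_ , noDraw , _) with m ≤? P + Q
... | yes m≤P+Q = ⊥-elim (noDraw (board P Q m m≤P+Q) (interval-isTri m) (firstLevels P)
                                  (draw P Q m m≤P+Q))
... | no  m≰P+Q = subst (_< m) (cong (_∸ 1) (sym (+-suc P Q))) (≰⇒> m≰P+Q)
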